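{- Let $\mathcal C$ be a simplicial complex with at least $m$ vertices, let $0\le d'<d$ be integers, and let $\rho$ be a $d'$-simplex of $\mathcal C$ that is contained in $N$ simplices of $\mathcal C$ of dimension $d$. Then $\mathcal C$ contains a set of $m$ vertices spanning at least \[\min\Bigl(N,\ \frac{2^{d+1}-2^{d'+1}}{d-d'}(m-d)\Bigr)\] simplices of $\mathcal C$.
   Context: A simplicial complex is a set system closed under taking subsets; a $k$-simplex is a $(k+1)$-element set. A set $V$ of vertices spans a simplex $\sigma$ of $\mathcal C$ if $\sigma\subseteq V$. -}

module Defs where

open import Data.Nat using (ℕ; zero; suc)
open import Data.Bool using (Bool; true; false)
open import Data.Vec using (Vec; []; _∷_)
open import Data.List using (List; []; _∷_; map; _++_; length; filter)
open import Data.Fin using (Fin)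
open import Data.Fin.Subset using (Subset; _⊆_; ⁅_⁆; ∣_∣; inside; outside)
open import Data.Fin.Subset.Properties using (_⊆?_)
open import Data.Fin.Base using () renaming (Fin to F)
open import Data.List using (allFin) renaming (tabulate to ltab)
open import Relation.Nullary using (Dec)
open import Relation.Nullary.Decidable using (_×-dec_)
open import Relation.Unary using (Pred; Decidable)
open import Data.Product using (_×_)
open import Level using (0ℓ)

record SimplicialComplex (n : ℕ) : Set₁ where
  field
    Face       : Subset n → Set
    face?      : (σ : Subset n) → Dec (Face σ)
    down-closed : ∀ {σ τ} → σ ⊆ τ → Face τ → Face σ
open SimplicialComplex public

allSubsets : (n : ℕ) → List (Subset n)
allSubsets zero = [] ∷ []
allSubsets (suc n) = map (outside ∷_) (allSubsets n) ++ map (inside ∷_) (allSubsets n)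

vertexCount : ∀ {n} → SimplicialComplex n → ℕ
vertexCount {n} C = length (filter (λ v → face? C ⁅ v ⁆) (allFin n))

IsVertexSet : ∀ {n} → SimplicialComplex n → Subset n → Set
IsVertexSet {n} C V = ∀ (v : Fin n) → v Data.Fin.Subset.∈ V → Face C ⁅ v ⁆

spanned : ∀ {n} → SimplicialComplex n → Subset n → ℕ
spanned {n} C V = length (filter (λ σ → face? C σ ×-dec (σ ⊆? V)) (allSubsets n))

-- number of d-simplices of C (faces with d+1 elements) containing ρ
cofaceCount : ∀ {n} → SimplicialComplex n → Subset n → ℕ → ℕ
cofaceCount {n} C ρ d =
  length (filter (λ τ → face? C τ ×-dec ((ρ ⊆? τ) ×-dec (∣ τ ∣ Data.Nat.≟ suc d))) (allSubsets n))

-- Grow a vertex set V greedily from ρ, adding one d-simplex τ ⊇ ρ at a time as long as at most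
-- m vertices are used. If V already contains s ≥ d'+1 vertices of τ, adding τ costs d+1−s new
-- vertices and gains the 2^(d+1) − 2^s faces of τ not inside V; by convexity of 2^x this is at
-- least (2^(d+1) − 2^(d'+1))/(d − d') new simplices per new vertex. The process stops either
-- when all N such τ lie in V, or when the next τ does not fit, which forces |V| > m − (d − d'),
-- so V already spans (2^(d+1) − 2^(d'+1))/(d − d') · (m − d) simplices. Padding V with further
-- vertices up to size m keeps both bounds.
module Submission where

open import Defs
open import Data.Nat using (ℕ; zero; suc; _+_; _*_; _∸_; _^_; _≤_; _<_; _⊓_; z≤n; s≤s; s≤s⁻¹; _≤?_; _≟_)
open import Data.Nat.Properties
open import Data.Nat.Tactic.RingSolver using (solve-∀)
open import Data.Fin using (Fin; zero; suc)
open import Data.Fin.Properties using (any?)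
open import Data.Fin.Subset using (Subset; ∣_∣; _⊆_; _∈_; _∉_; _∪_; _∩_; inside; outside; ⁅_⁆; ⊥)
open import Data.Fin.Subset.Properties
  using (_⊆?_; _∈?_; anySubset?; drop-∷-⊆; out⊆; in⊆in; ⊆-trans; ⊆-refl; ⊥⊆; ∣⊥∣≡0;
         p⊆q⇒∣p∣≤∣q∣; p⊂q⇒∣p∣<∣q∣; p⊆p∪q; q⊆p∪q; x∈p∪q⁻; x∈p∩q⁺; p∩q⊆p; p∩q⊆q; ∣p∩q∣≤∣q∣;
         x∈⁅y⁆⇒x≡y)
open import Data.Vec using ([]; _∷_; here; tabulate)
open import Data.Vec.Properties using (lookup∘tabulate; lookup⇒[]=; []=⇒lookup)
open import Data.List using (List; []; _∷_; map; _++_; length; filter)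
import Data.List as List
open import Data.List.Properties using (filter-≐; filter-++; filter-none; length-++)
open import Data.List.Relation.Unary.All using (universal)
open import Data.List.Relation.Binary.Sublist.Propositional.Properties using (filter⁺; length-mono-≤)
import Data.List.Relation.Binary.Sublist.Propositional as Sublist
open import Data.Product using (Σ; ∃; _×_; _,_; proj₁)
open import Data.Sum using (_⊎_; inj₁; inj₂; [_,_])
open import Function using (_∘_)
open import Relation.Binary.PropositionalEquality
  using (_≡_; refl; sym; trans; cong; cong₂; subst; subst₂; module ≡-Reasoning)
open import Relation.Nullary using (¬_; yes; no; does; contradiction)
open import Relation.Nullary.Decidable using (_×-dec_; ¬?; decidable-stable; dec-true)
open import Relation.Unary using (Pred; Decidable; _≐_)
open import Relation.Unary.Properties using (_∩?_; ∁?)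


module _ {a} {A : Set a} where

  count : ∀ {p} {P : Pred A p} → Decidable P → List A → ℕ
  count P? xs = length (filter P? xs)

  module _ {p q} {P : Pred A p} {Q : Pred A q} (P? : Decidable P) (Q? : Decidable Q) where

    count-mono : (∀ {x} → P x → Q x) → ∀ xs → count P? xs ≤ count Q? xs
    count-mono P⇒Q xs = length-mono-≤ (filter⁺ P? Q? (λ { refl → P⇒Q }) (Sublist.⊆-refl {x = xs}))

    count-≐ : P ≐ Q → ∀ xs → count P? xs ≡ count Q? xs
    count-≐ P≐Q xs = cong length (filter-≐ P? Q? P≐Q xs)

    count-split : ∀ xs → count P? xs ≡ count (P? ∩? Q?) xs + count (P? ∩? ∁? Q?) xs
    count-split [] = refl
    count-split (x ∷ xs) with P? x | Q? x
    ... | yes _ | yes _ = cong suc (count-split xs)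
    ... | yes _ | no _  = trans (cong suc (count-split xs)) (sym (+-suc _ _))
    ... | no _  | _     = count-split xs

  module _ {p} {P : Pred A p} (P? : Decidable P) where

    count-none : (∀ x → ¬ P x) → ∀ xs → count P? xs ≡ 0
    count-none ¬P xs = cong length (filter-none P? (universal ¬P xs))

    count-++ : ∀ xs ys → count P? (xs ++ ys) ≡ count P? xs + count P? ys
    count-++ xs ys = trans (cong length (filter-++ P? xs ys)) (length-++ (filter P? xs))

    count-tabulate : ∀ {k} (f : Fin k → A) →
      count P? (List.tabulate f) ≡ ∣ tabulate (λ i → does (P? (f i))) ∣
    count-tabulate {zero} f = refl
    count-tabulate {suc k} f with P? (f zero)
    ... | yes _ = cong suc (count-tabulate (f ∘ suc))
    ... | no _  = count-tabulate (f ∘ suc)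

  count-disjoint : ∀ {p q r} {P : Pred A p} {Q : Pred A q} {R : Pred A r}
    (P? : Decidable P) (Q? : Decidable Q) (R? : Decidable R) →
    (∀ {x} → P x → R x) → (∀ {x} → Q x → R x) → (∀ {x} → P x → ¬ Q x) →
    ∀ xs → count P? xs + count Q? xs ≤ count R? xs
  count-disjoint P? Q? R? P⇒R Q⇒R P⇒¬Q xs = begin
    count P? xs + count Q? xs
      ≤⟨ +-mono-≤ (count-mono P? (R? ∩? P?) (λ p → P⇒R p , p) xs)
                  (count-mono Q? (R? ∩? ∁? P?) (λ q → Q⇒R q , λ p → P⇒¬Q p q) xs) ⟩
    count (R? ∩? P?) xs + count (R? ∩? ∁? P?) xs
      ≡⟨ sym (count-split R? P? xs) ⟩
    count R? xs ∎
    where open ≤-Reasoning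

count-map : ∀ {a b p} {A : Set a} {B : Set b} {P : Pred B p} (P? : Decidable P) (f : A → B) xs →
  count P? (map f xs) ≡ count (λ x → P? (f x)) xs
count-map P? f [] = refl
count-map P? f (x ∷ xs) with P? (f x)
... | yes _ = cong suc (count-map P? f xs)
... | no _  = count-map P? f xs


in⊈out : ∀ {n} {p q : Subset n} → ¬ (inside ∷ p ⊆ outside ∷ q)
in⊈out inside∷p⊆outside∷q with inside∷p⊆outside∷q here
... | ()

countSubsets : ∀ {n p} {P : Pred (Subset n) p} → Decidable P → ℕ
countSubsets {n} P? = count P? (allSubsets n)

countSubsets-suc : ∀ {n p} {P : Pred (Subset (suc n)) p} (P? : Decidable P) →
  countSubsets P? ≡ countSubsets (λ σ → P? (outside ∷ σ)) + countSubsets (λ σ → P? (inside ∷ σ))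
countSubsets-suc {n} P? =
  trans (count-++ P? (map (outside ∷_) (allSubsets n)) (map (inside ∷_) (allSubsets n)))
        (cong₂ _+_ (count-map P? (outside ∷_) (allSubsets n)) (count-map P? (inside ∷_) (allSubsets n)))

countSubsets-⊆ : ∀ {n} (X : Subset n) → countSubsets (_⊆? X) ≡ 2 ^ ∣ X ∣
countSubsets-⊆ [] = refl
countSubsets-⊆ {suc n} (outside ∷ X) = begin
  countSubsets (_⊆? outside ∷ X)
    ≡⟨ countSubsets-suc (_⊆? outside ∷ X) ⟩
  countSubsets (λ σ → outside ∷ σ ⊆? outside ∷ X) + countSubsets (λ σ → inside ∷ σ ⊆? outside ∷ X)
    ≡⟨ cong₂ _+_ (count-≐ _ (_⊆? X) (drop-∷-⊆ , out⊆) (allSubsets n))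
                 (count-none (λ σ → inside ∷ σ ⊆? outside ∷ X) (λ _ → in⊈out) (allSubsets n)) ⟩
  countSubsets (_⊆? X) + 0
    ≡⟨ trans (+-identityʳ _) (countSubsets-⊆ X) ⟩
  2 ^ ∣ X ∣ ∎
  where open ≡-Reasoning
countSubsets-⊆ {suc n} (inside ∷ X) = begin
  countSubsets (_⊆? inside ∷ X)
    ≡⟨ countSubsets-suc (_⊆? inside ∷ X) ⟩
  countSubsets (λ σ → outside ∷ σ ⊆? inside ∷ X) + countSubsets (λ σ → inside ∷ σ ⊆? inside ∷ X)
    ≡⟨ cong₂ _+_ (count-≐ _ (_⊆? X) (drop-∷-⊆ , out⊆) (allSubsets n))
                 (count-≐ _ (_⊆? X) (drop-∷-⊆ , in⊆in) (allSubsets n)) ⟩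
  countSubsets (_⊆? X) + countSubsets (_⊆? X)
    ≡⟨ cong (λ c → c + c) (countSubsets-⊆ X) ⟩
  2 ^ ∣ X ∣ + 2 ^ ∣ X ∣
    ≡⟨ cong (2 ^ ∣ X ∣ +_) (sym (+-identityʳ _)) ⟩
  2 ^ ∣ inside ∷ X ∣ ∎
  where open ≡-Reasoning

countSubsets-⊆-⊈ : ∀ {n} (τ V : Subset n) →
  countSubsets ((_⊆? τ) ∩? ∁? (_⊆? V)) ≡ 2 ^ ∣ τ ∣ ∸ 2 ^ ∣ V ∩ τ ∣
countSubsets-⊆-⊈ {n} τ V = begin
  new                        ≡⟨ sym (m+n∸m≡n old new) ⟩
  old + new ∸ old            ≡⟨ cong (_∸ old) (sym (count-split (_⊆? τ) (_⊆? V) (allSubsets n))) ⟩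
  countSubsets (_⊆? τ) ∸ old ≡⟨ cong₂ _∸_ (countSubsets-⊆ τ) old≡ ⟩
  2 ^ ∣ τ ∣ ∸ 2 ^ ∣ V ∩ τ ∣  ∎
  where
  open ≡-Reasoning
  old = countSubsets ((_⊆? τ) ∩? (_⊆? V))
  new = countSubsets ((_⊆? τ) ∩? ∁? (_⊆? V))
  ⊆-∩ : ∀ {σ} → σ ⊆ τ × σ ⊆ V → σ ⊆ V ∩ τ
  ⊆-∩ (σ⊆τ , σ⊆V) x∈σ = x∈p∩q⁺ (σ⊆V x∈σ , σ⊆τ x∈σ)
  ∩-⊆ : ∀ {σ} → σ ⊆ V ∩ τ → σ ⊆ τ × σ ⊆ V
  ∩-⊆ σ⊆V∩τ = ⊆-trans σ⊆V∩τ (p∩q⊆q V τ) , ⊆-trans σ⊆V∩τ (p∩q⊆p V τ)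
  old≡ : old ≡ 2 ^ ∣ V ∩ τ ∣
  old≡ = trans (count-≐ _ (_⊆? V ∩ τ) (⊆-∩ , ∩-⊆) (allSubsets n)) (countSubsets-⊆ (V ∩ τ))


∣p∪q∣+∣p∩q∣≡∣p∣+∣q∣ : ∀ {n} (p q : Subset n) → ∣ p ∪ q ∣ + ∣ p ∩ q ∣ ≡ ∣ p ∣ + ∣ q ∣
∣p∪q∣+∣p∩q∣≡∣p∣+∣q∣ [] [] = refl
∣p∪q∣+∣p∩q∣≡∣p∣+∣q∣ (inside ∷ p) (inside ∷ q) =
  cong suc (trans (+-suc _ _) (trans (cong suc (∣p∪q∣+∣p∩q∣≡∣p∣+∣q∣ p q)) (sym (+-suc _ _))))
∣p∪q∣+∣p∩q∣≡∣p∣+∣q∣ (inside ∷ p) (outside ∷ q) = cong suc (∣p∪q∣+∣p∩q∣≡∣p∣+∣q∣ p q)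
∣p∪q∣+∣p∩q∣≡∣p∣+∣q∣ (outside ∷ p) (inside ∷ q) =
  trans (cong suc (∣p∪q∣+∣p∩q∣≡∣p∣+∣q∣ p q)) (sym (+-suc _ _))
∣p∪q∣+∣p∩q∣≡∣p∣+∣q∣ (outside ∷ p) (outside ∷ q) = ∣p∪q∣+∣p∩q∣≡∣p∣+∣q∣ p q

∣p∪q∣≡∣p∣+[∣q∣∸∣p∩q∣] : ∀ {n} (p q : Subset n) → ∣ p ∪ q ∣ ≡ ∣ p ∣ + (∣ q ∣ ∸ ∣ p ∩ q ∣)
∣p∪q∣≡∣p∣+[∣q∣∸∣p∩q∣] p q = begin
  ∣ p ∪ q ∣                          ≡⟨ sym (m+n∸n≡m ∣ p ∪ q ∣ ∣ p ∩ q ∣) ⟩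
  ∣ p ∪ q ∣ + ∣ p ∩ q ∣ ∸ ∣ p ∩ q ∣  ≡⟨ cong (_∸ ∣ p ∩ q ∣) (∣p∪q∣+∣p∩q∣≡∣p∣+∣q∣ p q) ⟩
  ∣ p ∣ + ∣ q ∣ ∸ ∣ p ∩ q ∣          ≡⟨ +-∸-assoc ∣ p ∣ (∣p∩q∣≤∣q∣ p q) ⟩
  ∣ p ∣ + (∣ q ∣ ∸ ∣ p ∩ q ∣) ∎
  where open ≡-Reasoning

⊈⇒∃∉ : ∀ {n} {p q : Subset n} → ¬ p ⊆ q → ∃ λ x → x ∈ p × x ∉ q
⊈⇒∃∉ {p = p} {q} p⊈q with any? (λ x → (x ∈? p) ×-dec ¬? (x ∈? q))
... | yes witness = witness
... | no none = contradiction (λ {x} x∈p → decidable-stable (x ∈? q) (λ x∉q → none (x , x∈p , x∉q))) p⊈q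

∣p∣<∣p∪q∣ : ∀ {n} {p q : Subset n} → ¬ q ⊆ p → ∣ p ∣ < ∣ p ∪ q ∣
∣p∣<∣p∪q∣ {p = p} {q} q⊈p with x , x∈q , x∉p ← ⊈⇒∃∉ q⊈p =
  p⊂q⇒∣p∣<∣q∣ (p⊆p∪q q , x , q⊆p∪q p q x∈q , x∉p)

∪-least : ∀ {n} {p q r : Subset n} → p ⊆ r → q ⊆ r → p ∪ q ⊆ r
∪-least {p = p} {q} p⊆r q⊆r x∈p∪q = [ p⊆r , q⊆r ] (x∈p∪q⁻ p q x∈p∪q)

subset-of-size : ∀ {n} {V W : Subset n} m → V ⊆ W → ∣ V ∣ ≤ m → m ≤ ∣ W ∣ →
  ∃ λ U → V ⊆ U × U ⊆ W × ∣ U ∣ ≡ m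
subset-of-size {V = []} {[]} zero _ _ _ = [] , ⊆-refl , ⊆-refl , refl
subset-of-size {V = inside ∷ V} {outside ∷ W} m V⊆W _ _ = contradiction (λ {x} → V⊆W {x}) in⊈out
subset-of-size {V = outside ∷ V} {outside ∷ W} m V⊆W ∣V∣≤m m≤∣W∣
  with U , V⊆U , U⊆W , refl ← subset-of-size m (drop-∷-⊆ V⊆W) ∣V∣≤m m≤∣W∣ =
  outside ∷ U , out⊆ V⊆U , out⊆ U⊆W , refl
subset-of-size {V = inside ∷ V} {inside ∷ W} (suc m) V⊆W (s≤s ∣V∣≤m) (s≤s m≤∣W∣)
  with U , V⊆U , U⊆W , refl ← subset-of-size m (drop-∷-⊆ V⊆W) ∣V∣≤m m≤∣W∣ =
  inside ∷ U , in⊆in V⊆U , in⊆in U⊆W , refl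
subset-of-size {V = outside ∷ V} {inside ∷ W} m V⊆W ∣V∣≤m m≤1+∣W∣ with m ≤? ∣ W ∣
... | yes m≤∣W∣ with U , V⊆U , U⊆W , refl ← subset-of-size m (drop-∷-⊆ V⊆W) ∣V∣≤m m≤∣W∣ =
  outside ∷ U , out⊆ V⊆U , out⊆ U⊆W , refl
subset-of-size {V = outside ∷ V} {inside ∷ W} zero _ _ _ | no 0≰∣W∣ = contradiction z≤n 0≰∣W∣
subset-of-size {V = outside ∷ V} {inside ∷ W} (suc m) V⊆W _ (s≤s m≤∣W∣) | no 1+m≰∣W∣
  with U , V⊆U , U⊆W , refl ← subset-of-size m (drop-∷-⊆ V⊆W)
         (≤-trans (p⊆q⇒∣p∣≤∣q∣ (drop-∷-⊆ V⊆W)) (s≤s⁻¹ (≰⇒> 1+m≰∣W∣))) m≤∣W∣ =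
  inside ∷ U , out⊆ V⊆U , in⊆in U⊆W , refl


m+o≤n+p⇒m∸p≤n∸o : ∀ {m n o p} → m + o ≤ n + p → m ∸ p ≤ n ∸ o
m+o≤n+p⇒m∸p≤n∸o {m} {n} {o} {p} m+o≤n+p = begin
  m ∸ p              ≡⟨ sym ([m+n]∸[m+o]≡n∸o o m p) ⟩
  o + m ∸ (o + p)    ≡⟨ cong (_∸ (o + p)) (+-comm o m) ⟩
  m + o ∸ (o + p)    ≤⟨ ∸-monoˡ-≤ (o + p) m+o≤n+p ⟩
  n + p ∸ (o + p)    ≡⟨ cong₂ _∸_ (+-comm n p) (+-comm o p) ⟩
  p + n ∸ (p + o)    ≡⟨ [m+n]∸[m+o]≡n∸o p n o ⟩
  n ∸ o              ∎
  where open ≤-Reasoning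

m≤n+[o∸p]⇒m∸o≤n∸p : ∀ {m n o p} → p ≤ o → m ≤ n + (o ∸ p) → m ∸ o ≤ n ∸ p
m≤n+[o∸p]⇒m∸o≤n∸p {m} {n} {o} {p} p≤o m≤n+[o∸p] = m+o≤n+p⇒m∸p≤n∸o {m} {n} {p} {o} (begin
  m + p             ≤⟨ +-monoˡ-≤ p m≤n+[o∸p] ⟩
  n + (o ∸ p) + p   ≡⟨ +-assoc n (o ∸ p) p ⟩
  n + (o ∸ p + p)   ≡⟨ cong (n +_) (m∸n+n≡m p≤o) ⟩
  n + o             ∎)
  where open ≤-Reasoning

n<2^n : ∀ n → n < 2 ^ n
n<2^n zero = s≤s z≤n
n<2^n (suc n) = begin
  2 + n              ≡⟨ +-comm 1 (suc n) ⟩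
  suc n + 1          ≤⟨ +-mono-≤ (n<2^n n) (m^n>0 2 n) ⟩
  2 ^ n + 2 ^ n      ≡⟨ cong (2 ^ n +_) (sym (+-identityʳ (2 ^ n))) ⟩
  2 ^ suc n          ∎
  where open ≤-Reasoning

2^n≤n*2^n+1 : ∀ n → 2 ^ n ≤ n * 2 ^ n + 1
2^n≤n*2^n+1 zero = ≤-refl
2^n≤n*2^n+1 (suc n) = ≤-trans (m≤m+n (2 ^ suc n) (n * 2 ^ suc n)) (m≤m+n _ 1)

-- With X = 2^i and Y = 2^j this is the chord inequality for 2^x on [0, i + j] at the point i,
-- multiplied out: (XY − 1)·j ≤ (i + j)·X·(Y − 1).
chord-core : ∀ i j {X Y} → X ≤ i * X + 1 → suc j ≤ Y → X * Y * j + (i + j) * X ≤ (i + j) * (X * Y) + j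
chord-core i j {X} {Y} X≤iX+1 1+j≤Y = begin
  X * Y * j + (i + j) * X        ≤⟨ +-monoʳ-≤ (X * Y * j) core ⟩
  X * Y * j + (i * (X * Y) + j)  ≡⟨ collect i j X Y ⟩
  (i + j) * (X * Y) + j          ∎
  where
  open ≤-Reasoning
  collect : ∀ i j X Y → X * Y * j + (i * (X * Y) + j) ≡ (i + j) * (X * Y) + j
  collect = solve-∀
  expand : ∀ i j X → i * X + j * (i * X + 1) ≡ i * (X * suc j) + j
  expand = solve-∀
  core : (i + j) * X ≤ i * (X * Y) + j
  core = begin
    (i + j) * X              ≡⟨ *-distribʳ-+ X i j ⟩
    i * X + j * X            ≤⟨ +-monoʳ-≤ (i * X) (*-monoʳ-≤ j X≤iX+1) ⟩
    i * X + j * (i * X + 1)  ≡⟨ expand i j X ⟩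
    i * (X * suc j) + j      ≤⟨ +-monoˡ-≤ j (*-monoʳ-≤ i (*-monoʳ-≤ X 1+j≤Y)) ⟩
    i * (X * Y) + j          ∎

chord-scaled : ∀ i j P {X Y} → X ≤ i * X + 1 → suc j ≤ Y →
  (P * X * Y ∸ P) * j ≤ (i + j) * (P * X * Y ∸ P * X)
chord-scaled i j P {X} {Y} X≤iX+1 1+j≤Y = begin
  (P * X * Y ∸ P) * j                        ≡⟨ *-distribʳ-∸ j (P * X * Y) P ⟩
  P * X * Y * j ∸ P * j                      ≤⟨ m+o≤n+p⇒m∸p≤n∸o {P * X * Y * j} {(i + j) * (P * X * Y)}
                                                   {(i + j) * (P * X)} {P * j} scaled ⟩
  (i + j) * (P * X * Y) ∸ (i + j) * (P * X)  ≡⟨ sym (*-distribˡ-∸ (i + j) (P * X * Y) (P * X)) ⟩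
  (i + j) * (P * X * Y ∸ P * X)              ∎
  where
  open ≤-Reasoning
  factorˡ : ∀ P X Y i j → P * X * Y * j + (i + j) * (P * X) ≡ P * (X * Y * j + (i + j) * X)
  factorˡ = solve-∀
  factorʳ : ∀ P X Y i j → P * ((i + j) * (X * Y) + j) ≡ (i + j) * (P * X * Y) + P * j
  factorʳ = solve-∀
  scaled : P * X * Y * j + (i + j) * (P * X) ≤ (i + j) * (P * X * Y) + P * j
  scaled = begin
    P * X * Y * j + (i + j) * (P * X)  ≡⟨ factorˡ P X Y i j ⟩
    P * (X * Y * j + (i + j) * X)      ≤⟨ *-monoʳ-≤ P (chord-core i j X≤iX+1 1+j≤Y) ⟩
    P * ((i + j) * (X * Y) + j)        ≡⟨ factorʳ P X Y i j ⟩
    (i + j) * (P * X * Y) + P * j      ∎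

2^-chord : ∀ {a s b} → a ≤ s → s ≤ b → (2 ^ b ∸ 2 ^ a) * (b ∸ s) ≤ (b ∸ a) * (2 ^ b ∸ 2 ^ s)
2^-chord {a} a≤s s≤b with i , refl ← m≤n⇒∃[o]m+o≡n a≤s | j , refl ← m≤n⇒∃[o]m+o≡n s≤b =
  subst₂ _≤_ (cong₂ (λ x y → (x ∸ 2 ^ a) * y) (sym 2^b) (sym (m+n∸m≡n (a + i) j)))
             (cong₂ _*_ (sym b-a) (cong₂ _∸_ (sym 2^b) (sym 2^s)))
             (chord-scaled i j (2 ^ a) (2^n≤n*2^n+1 i) (n<2^n j))
  where
  2^s : 2 ^ (a + i) ≡ 2 ^ a * 2 ^ i
  2^s = ^-distribˡ-+-* 2 a i
  2^b : 2 ^ (a + i + j) ≡ 2 ^ a * 2 ^ i * 2 ^ j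
  2^b = trans (^-distribˡ-+-* 2 (a + i) j) (cong (_* 2 ^ j) 2^s)
  b-a : a + i + j ∸ a ≡ i + j
  b-a = trans (cong (_∸ a) (+-assoc a i j)) (m+n∸m≡n a (i + j))


module _ {n} (C : SimplicialComplex n) where

  vertices : Subset n
  vertices = tabulate (λ v → does (face? C ⁅ v ⁆))

  ∈-vertices⁺ : ∀ {v} → Face C ⁅ v ⁆ → v ∈ vertices
  ∈-vertices⁺ {v} ⁅v⁆∈C =
    lookup⇒[]= v vertices (trans (lookup∘tabulate _ v) (dec-true (face? C ⁅ v ⁆) ⁅v⁆∈C))

  ∈-vertices⁻ : ∀ {v} → v ∈ vertices → Face C ⁅ v ⁆
  ∈-vertices⁻ {v} v∈vertices
    with face? C ⁅ v ⁆ | trans (sym (lookup∘tabulate _ v)) ([]=⇒lookup v∈vertices)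
  ... | yes ⁅v⁆∈C | _ = ⁅v⁆∈C
  ... | no _ | ()

  face⊆vertices : ∀ {σ} → Face C σ → σ ⊆ vertices
  face⊆vertices σ∈C {v} v∈σ =
    ∈-vertices⁺ (down-closed C (λ x∈⁅v⁆ → subst (_∈ _) (sym (x∈⁅y⁆⇒x≡y v x∈⁅v⁆)) v∈σ) σ∈C)

  vertexCount≡∣vertices∣ : vertexCount C ≡ ∣ vertices ∣
  vertexCount≡∣vertices∣ = count-tabulate (λ v → face? C ⁅ v ⁆) (λ v → v)

  spanned-mono : ∀ {V W} → V ⊆ W → spanned C V ≤ spanned C W
  spanned-mono V⊆W = count-mono (face? C ∩? (_⊆? _)) (face? C ∩? (_⊆? _))
    (λ (σ∈C , σ⊆V) → σ∈C , ⊆-trans σ⊆V V⊆W) (allSubsets n)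

  -- The faces of τ not inside V are new simplices spanned by V ∪ τ.
  spanned-∪-face : ∀ {τ} V → Face C τ →
    spanned C V + (2 ^ ∣ τ ∣ ∸ 2 ^ ∣ V ∩ τ ∣) ≤ spanned C (V ∪ τ)
  spanned-∪-face {τ} V τ∈C =
    subst (λ new → spanned C V + new ≤ spanned C (V ∪ τ)) (countSubsets-⊆-⊈ τ V)
    (count-disjoint (face? C ∩? (_⊆? V)) ((_⊆? τ) ∩? ∁? (_⊆? V)) (face? C ∩? (_⊆? V ∪ τ))
      (λ (σ∈C , σ⊆V) → σ∈C , ⊆-trans σ⊆V (p⊆p∪q τ))
      (λ (σ⊆τ , _) → down-closed C σ⊆τ τ∈C , ⊆-trans σ⊆τ (q⊆p∪q V τ))
      (λ (_ , σ⊆V) (_ , σ⊈V) → σ⊈V σ⊆V)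
      (allSubsets n))

  vertexSet-⊇-of-size : ∀ {V} m → V ⊆ vertices → ∣ V ∣ ≤ m → m ≤ vertexCount C →
    ∃ λ U → V ⊆ U × IsVertexSet C U × ∣ U ∣ ≡ m
  vertexSet-⊇-of-size m V⊆vertices ∣V∣≤m m≤#vertices
    with U , V⊆U , U⊆vertices , ∣U∣≡m ← subset-of-size m V⊆vertices ∣V∣≤m
                                         (subst (m ≤_) vertexCount≡∣vertices∣ m≤#vertices) =
    U , V⊆U , (λ v v∈U → ∈-vertices⁻ (U⊆vertices v∈U)) , ∣U∣≡m


module Greedy {n} (C : SimplicialComplex n) (ρ : Subset n) (d' d m : ℕ) (∣ρ∣≡1+d' : ∣ ρ ∣ ≡ suc d') where

  den num : ℕ
  den = d ∸ d'
  num = 2 ^ suc d ∸ 2 ^ suc d'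

  Coface : Subset n → Set
  Coface τ = Face C τ × ρ ⊆ τ × ∣ τ ∣ ≡ suc d

  coface? : Decidable Coface
  coface? τ = face? C τ ×-dec ((ρ ⊆? τ) ×-dec (∣ τ ∣ ≟ suc d))

  -- V spans at least (num / den)·(∣ V ∣ − ∣ ρ ∣) simplices.
  Invariant : Subset n → Set
  Invariant V = num * ∣ V ∣ ≤ den * spanned C V + num * suc d'

  record Admissible (V : Subset n) : Set where
    constructor admissible
    field
      ρ⊆V        : ρ ⊆ V
      V⊆vertices : V ⊆ vertices C
      ∣V∣≤m      : ∣ V ∣ ≤ m
      invariant  : Invariant V

  Bound : Subset n → Set
  Bound V = (cofaceCount C ρ d * den) ⊓ (num * (m ∸ d)) ≤ den * spanned C V

  Outcome : Subset n → Set
  Outcome V = V ⊆ vertices C × ∣ V ∣ ≤ m × Bound V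

  1+d'≤∣V∩τ∣ : ∀ {V τ} → ρ ⊆ V → ρ ⊆ τ → suc d' ≤ ∣ V ∩ τ ∣
  1+d'≤∣V∩τ∣ ρ⊆V ρ⊆τ = subst (_≤ _) ∣ρ∣≡1+d' (p⊆q⇒∣p∣≤∣q∣ (λ x∈ρ → x∈p∩q⁺ (ρ⊆V x∈ρ , ρ⊆τ x∈ρ)))

  ∣V∩τ∣≤1+d : ∀ V {τ} → Coface τ → ∣ V ∩ τ ∣ ≤ suc d
  ∣V∩τ∣≤1+d V {τ} (_ , _ , ∣τ∣≡1+d) = subst (∣ V ∩ τ ∣ ≤_) ∣τ∣≡1+d (∣p∩q∣≤∣q∣ V τ)

  invariant-ρ : Invariant ρ
  invariant-ρ = subst (λ r → num * r ≤ den * spanned C ρ + num * suc d') (sym ∣ρ∣≡1+d') (m≤n+m _ _)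

  invariant-∪ : ∀ {V τ} → Coface τ → ρ ⊆ V → Invariant V → Invariant (V ∪ τ)
  invariant-∪ {V} {τ} τ-coface@(τ∈C , ρ⊆τ , ∣τ∣≡1+d) ρ⊆V inv = begin
    num * ∣ V ∪ τ ∣                                ≡⟨ cong (num *_) (∣p∪q∣≡∣p∣+[∣q∣∸∣p∩q∣] V τ) ⟩
    num * (∣ V ∣ + (∣ τ ∣ ∸ s))                    ≡⟨ *-distribˡ-+ num ∣ V ∣ (∣ τ ∣ ∸ s) ⟩
    num * ∣ V ∣ + num * (∣ τ ∣ ∸ s)                ≤⟨ +-mono-≤ inv chord ⟩
    den * spanned C V + num * suc d' + den * gain  ≡⟨ regroup den (spanned C V) (num * suc d') gain ⟩
    den * (spanned C V + gain) + num * suc d'      ≤⟨ +-monoˡ-≤ (num * suc d')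
                                                         (*-monoʳ-≤ den (spanned-∪-face C V τ∈C)) ⟩
    den * spanned C (V ∪ τ) + num * suc d'         ∎
    where
    open ≤-Reasoning
    s = ∣ V ∩ τ ∣
    gain = 2 ^ ∣ τ ∣ ∸ 2 ^ s
    chord : num * (∣ τ ∣ ∸ s) ≤ den * gain
    chord rewrite ∣τ∣≡1+d = 2^-chord (1+d'≤∣V∩τ∣ ρ⊆V ρ⊆τ) (∣V∩τ∣≤1+d V τ-coface)
    regroup : ∀ k x y z → k * x + y + k * z ≡ k * (x + z) + y
    regroup = solve-∀

  -- If τ does not fit then ∣ V ∣ > m − (d − d'), as τ shares ρ with V and so has at most d − d'
  -- vertices outside V.
  stuck-bound : ∀ {V τ} → Coface τ → ρ ⊆ V → m < ∣ V ∪ τ ∣ → Invariant V →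
    num * (m ∸ d) ≤ den * spanned C V
  stuck-bound {V} {τ} τ-coface@(_ , ρ⊆τ , ∣τ∣≡1+d) ρ⊆V m<∣V∪τ∣ inv = begin
    num * (m ∸ d)                                    ≤⟨ *-monoʳ-≤ num m∸d≤∣V∣∸1+d' ⟩
    num * (∣ V ∣ ∸ suc d')                           ≡⟨ *-distribˡ-∸ num ∣ V ∣ (suc d') ⟩
    num * ∣ V ∣ ∸ num * suc d'                       ≤⟨ ∸-monoˡ-≤ (num * suc d') inv ⟩
    den * spanned C V + num * suc d' ∸ num * suc d'  ≡⟨ m+n∸n≡m (den * spanned C V) (num * suc d') ⟩
    den * spanned C V                                ∎
    where
    open ≤-Reasoning
    1+d'≤s = 1+d'≤∣V∩τ∣ ρ⊆V ρ⊆τ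
    1+m≤∣V∣+[1+d∸1+d'] : suc m ≤ ∣ V ∣ + (suc d ∸ suc d')
    1+m≤∣V∣+[1+d∸1+d'] = begin
      suc m                         ≤⟨ m<∣V∪τ∣ ⟩
      ∣ V ∪ τ ∣                     ≡⟨ ∣p∪q∣≡∣p∣+[∣q∣∸∣p∩q∣] V τ ⟩
      ∣ V ∣ + (∣ τ ∣ ∸ ∣ V ∩ τ ∣)   ≡⟨ cong (λ t → ∣ V ∣ + (t ∸ ∣ V ∩ τ ∣)) ∣τ∣≡1+d ⟩
      ∣ V ∣ + (suc d ∸ ∣ V ∩ τ ∣)   ≤⟨ +-monoʳ-≤ ∣ V ∣ (∸-monoʳ-≤ (suc d) 1+d'≤s) ⟩
      ∣ V ∣ + (suc d ∸ suc d')      ∎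
    m∸d≤∣V∣∸1+d' : m ∸ d ≤ ∣ V ∣ ∸ suc d'
    m∸d≤∣V∣∸1+d' = m≤n+[o∸p]⇒m∸o≤n∸p (≤-trans 1+d'≤s (∣V∩τ∣≤1+d V τ-coface)) 1+m≤∣V∣+[1+d∸1+d']

  extend-or-stop : ∀ {V} → Admissible V → (∃ λ W → ∣ V ∣ < ∣ W ∣ × Admissible W) ⊎ Outcome V
  extend-or-stop {V} (admissible ρ⊆V V⊆vertices ∣V∣≤m inv) with anySubset? (coface? ∩? ∁? (_⊆? V))
  ... | no no-coface-outside = inj₂ (V⊆vertices , ∣V∣≤m , ≤-trans (m⊓n≤m _ _) all-cofaces-spanned)
    where
    coface⊆V : ∀ {τ} → Coface τ → τ ⊆ V
    coface⊆V τ-coface = decidable-stable (_ ⊆? V) (λ τ⊈V → no-coface-outside (_ , τ-coface , τ⊈V))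
    all-cofaces-spanned : cofaceCount C ρ d * den ≤ den * spanned C V
    all-cofaces-spanned = ≤-trans (≤-reflexive (*-comm _ den)) (*-monoʳ-≤ den
      (count-mono coface? (face? C ∩? (_⊆? V)) (λ τ-coface → proj₁ τ-coface , coface⊆V τ-coface)
                  (allSubsets n)))
  ... | yes (τ , τ-coface@(τ∈C , _) , τ⊈V) with ∣ V ∪ τ ∣ ≤? m
  ...   | yes fits = inj₁ (V ∪ τ , ∣p∣<∣p∪q∣ τ⊈V ,
            admissible (⊆-trans ρ⊆V (p⊆p∪q τ)) (∪-least V⊆vertices (face⊆vertices C τ∈C)) fits
                       (invariant-∪ τ-coface ρ⊆V inv))
  ...   | no overflow = inj₂ (V⊆vertices , ∣V∣≤m ,
            ≤-trans (m⊓n≤n _ _) (stuck-bound τ-coface ρ⊆V (≰⇒> overflow) inv))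

  greedy : ∀ fuel {V} → m ≤ ∣ V ∣ + fuel → Admissible V → ∃ Outcome
  greedy zero {V} budget V-admissible with extend-or-stop V-admissible
  ... | inj₂ done = V , done
  ... | inj₁ (W , ∣V∣<∣W∣ , admissible _ _ ∣W∣≤m _) =
    contradiction (subst (m ≤_) (+-identityʳ ∣ V ∣) budget) (<⇒≱ (<-≤-trans ∣V∣<∣W∣ ∣W∣≤m))
  greedy (suc fuel) {V} budget V-admissible with extend-or-stop V-admissible
  ... | inj₂ done = V , done
  ... | inj₁ (W , ∣V∣<∣W∣ , W-admissible) =
    greedy fuel (≤-trans budget (≤-trans (≤-reflexive (+-suc ∣ V ∣ fuel)) (+-monoˡ-≤ fuel ∣V∣<∣W∣)))
           W-admissible

  greedy-from-ρ : Face C ρ → suc d' ≤ m → ∃ Outcome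
  greedy-from-ρ ρ∈C 1+d'≤m = greedy m (m≤n+m m ∣ ρ ∣)
    (admissible ⊆-refl (face⊆vertices C ρ∈C) (subst (_≤ m) (sym ∣ρ∣≡1+d') 1+d'≤m) invariant-ρ)

  outcome-⊥ : m ≤ d → Outcome ⊥
  outcome-⊥ m≤d = ⊥⊆ , subst (_≤ m) (sym (∣⊥∣≡0 n)) z≤n ,
    ≤-trans (m⊓n≤n _ _) (≤-trans (≤-reflexive num*[m∸d]≡0) z≤n)
    where
    num*[m∸d]≡0 : num * (m ∸ d) ≡ 0
    num*[m∸d]≡0 = trans (cong (num *_) (m≤n⇒m∸n≡0 m≤d)) (*-zeroʳ num)

  padded : ∃ Outcome → m ≤ vertexCount C → ∃ λ U → IsVertexSet C U × ∣ U ∣ ≡ m × Bound U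
  padded (V , V⊆vertices , ∣V∣≤m , bound) m≤#vertices
    with U , V⊆U , U-vertices , ∣U∣≡m ← vertexSet-⊇-of-size C m V⊆vertices ∣V∣≤m m≤#vertices =
    U , U-vertices , ∣U∣≡m , ≤-trans bound (*-monoʳ-≤ den (spanned-mono C V⊆U))


lemma7 : ∀ {n} (C : SimplicialComplex n) (m d' d N : ℕ) (ρ : Subset n) →
    m ≤ vertexCount C → d' < d →
    Face C ρ → ∣ ρ ∣ ≡ suc d' → cofaceCount C ρ d ≡ N →
    Σ (Subset n) λ V → IsVertexSet C V × ∣ V ∣ ≡ m ×
    ((N * (d ∸ d')) ⊓ ((2 ^ (d + 1) ∸ 2 ^ (d' + 1)) * (m ∸ d)) ≤ (d ∸ d') * spanned C V)
lemma7 C m d' d _ ρ m≤#vertices d'<d ρ∈C ∣ρ∣≡1+d' refl rewrite +-comm d 1 | +-comm d' 1 =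
  padded start m≤#vertices
  where
  open Greedy C ρ d' d m ∣ρ∣≡1+d'
  start : ∃ Outcome
  start with suc d' ≤? m
  ... | yes 1+d'≤m = greedy-from-ρ ρ∈C 1+d'≤m
  ... | no 1+d'≰m = ⊥ , outcome-⊥ (≤-trans (s≤s⁻¹ (≰⇒> 1+d'≰m)) (<⇒≤ d'<d))
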